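{- (Total-correctness soundness.) For any statement $s$, state predicate $U$ and setoid trace predicate $P$, if $\vdash\{U\}\,s\,\{P\}$ is derivable in the trace-based Hoare logic, then for every state $\sigma$ with $\sigma\models U$ there exists a trace $\tau$ such that $s,\sigma\Rightarrow\tau$ and $\tau\models P$.
   Context: While statements: $s ::= x:=e \mid \mathsf{skip}\mid s_0;s_1\mid \mathsf{if}\ e\ \mathsf{then}\ s_t\ \mathsf{else}\ s_f\mid \mathsf{while}\ e\ \mathsf{do}\ s_t$, with $x$ integer variables and $e$ arithmetic expressions; a state $\sigma$ assigns integers to variables, $[\![e]\!]\sigma$ is the value, $\sigma\models e$ means $e$ is true in $\sigma$. The metatheory is constructive. Traces are coinductive: $\langle\sigma\rangle$, and $\sigma::\tau$ for a trace $\tau$; bisimilarity $\approx$ is coinductive ($\langle\sigma\rangle\approx\langle\sigma\rangle$; $\sigma::\tau\approx\sigma::\tau'$ if $\tau\approx\tau'$); $\mathit{hd}\langle\sigma\rangle=\mathit{hd}(\sigma::\tau)=\sigma$. Evaluation $s,\sigma\Rightarrow\tau$ and extended evaluation $s,\tau\Rightarrow^*\tau'$ are defined simultaneously coinductively by: $x:=e,\sigma\Rightarrow\sigma::\langle\sigma[x\mapsto[\![e]\!]\sigma]\rangle$; $\mathsf{skip},\sigma\Rightarrow\langle\sigma\rangle$; $s_0;s_1,\sigma\Rightarrow\tau'$ if $s_0,\sigma\Rightarrow\tau$ and $s_1,\tau\Rightarrow^*\tau'$; $\mathsf{if}\ e\ \mathsf{then}\ s_t\ \mathsf{else}\ s_f,\sigma\Rightarrow\tau$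 if $\sigma\models e$ and $s_t,\sigma::\langle\sigma\rangle\Rightarrow^*\tau$, or if $\sigma\not\models e$ and $s_f,\sigma::\langle\sigma\rangle\Rightarrow^*\tau$; $\mathsf{while}\ e\ \mathsf{do}\ s_t,\sigma\Rightarrow\tau'$ if $\sigma\models e$, $s_t,\sigma::\langle\sigma\rangle\Rightarrow^*\tau$ and $\mathsf{while}\ e\ \mathsf{do}\ s_t,\tau\Rightarrow^*\tau'$; $\mathsf{while}\ e\ \mathsf{do}\ s_t,\sigma\Rightarrow\sigma::\langle\sigma\rangle$ if $\sigma\not\models e$; $s,\langle\sigma\rangle\Rightarrow^*\tau$ if $s,\sigma\Rightarrow\tau$; $s,\sigma::\tau\Rightarrow^*\sigma::\tau'$ if $s,\tau\Rightarrow^*\tau'$. State predicates are arbitrary; trace predicates are setoid predicates (invariant under $\approx$); $\wedge,\neg,\exists$ are pointwise; $\models$ is also entailment. $\langle U\rangle$ holds exactly of $\langle\sigma\rangle$ with $\sigma\models U$; $\mathrm{dup}(U)$ exactly of $\sigma::\langle\sigma\rangle$ with $\sigma\models U$; $U[x\mapsto e]$ exactly of $\sigma::\langle\sigma[x\mapsto[\![e]\!]\sigma]\rangle$ with $\sigma\models U$. $\mathrm{follows}_Q(\tau,\tau')$ is coinductive: $\mathrm{follows}_Q(\langle\sigma\rangle,\tau)$ if $\mathit{hd}\,\tau=\sigma$ and $\tau\models Q$; $\mathrm{follows}_Q(\sigma::\tau,\sigma::\tau')$ if $\mathrm{follows}_Q(\tau,\tau')$. $\tau'\models P\ast\ast Q$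 iff $\exists\tau$, $\tau\models P$ and $\mathrm{follows}_Q(\tau,\tau')$ (chains associate to the right). $P^{\dagger}$ is coinductive: $\tau\models P^{\dagger}$ if $\tau\models\langle\mathsf{true}\rangle$; $\tau'\models P^{\dagger}$ if $\exists\tau$, $\tau\models P$ and $\mathrm{follows}_{P^{\dagger}}(\tau,\tau')$. The trace-based Hoare logic derives $\{U\}\,s\,\{P\}$ inductively by: $\{U\}\,x:=e\,\{U[x\mapsto e]\}$; $\{U\}\,\mathsf{skip}\,\{\langle U\rangle\}$; from $\{U\}\,s_0\,\{P\ast\ast\langle V\rangle\}$ and $\{V\}\,s_1\,\{Q\}$ infer $\{U\}\,s_0;s_1\,\{P\ast\ast Q\}$; from $\{e\wedge U\}\,s_t\,\{P\}$ and $\{\neg e\wedge U\}\,s_f\,\{P\}$ infer $\{U\}\,\mathsf{if}\ e\ \mathsf{then}\ s_t\ \mathsf{else}\ s_f\,\{\mathrm{dup}(U)\ast\ast P\}$; from $U\models I$ and $\{e\wedge I\}\,s_t\,\{P\ast\ast\langle I\rangle\}$ infer $\{U\}\,\mathsf{while}\ e\ \mathsf{do}\ s_t\,\{\mathrm{dup}(U)\ast\ast(P\ast\ast\mathrm{dup}(I))^{\dagger}\ast\ast\langle\neg e\rangle\}$; from $U\models U'$, $\{U'\}\,s\,\{P'\}$, $P'\models P$ infer $\{U\}\,s\,\{P\}$; from $\forall z.\ \{U_z\}\,s\,\{P_z\}$ infer $\{\exists z.U_z\}\,s\,\{\exists z.P_z\}$. -}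

module Defs where

open import Level using (Level; _⊔_; Lift; lift) renaming (suc to lsuc; zero to lzero)
open import Data.Nat as ℕ using (ℕ; _≡ᵇ_)
open import Data.Integer as ℤ using (ℤ; +_)
open import Data.Bool using (Bool; true; false) renaming (if_then_else_ to ifᵇ_then_else_)
open import Data.Product using (Σ; _×_; _,_)
open import Data.Sum using (_⊎_; inj₁; inj₂)
open import Data.Empty using (⊥)
open import Relation.Nullary using (¬_; does)
open import Relation.Binary.PropositionalEquality using (_≡_; refl; _≢_; sym; trans)

Var : Set
Var = ℕ

State : Set
State = Var → ℤ

data Expr : Set where
  var  : Var → Expr
  con  : ℤ → Expr
  _⊕_  : Expr → Expr → Expr
  _⊖_  : Expr → Expr → Expr
  _⊗_  : Expr → Expr → Expr
  _≐_  : Expr → Expr → Expr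
  _≺_  : Expr → Expr → Expr

b2z : Bool → ℤ
b2z true  = + 1
b2z false = + 0

⟦_⟧ : Expr → State → ℤ
⟦ var x ⟧ σ = σ x
⟦ con n ⟧ σ = n
⟦ a ⊕ b ⟧ σ = ⟦ a ⟧ σ ℤ.+ ⟦ b ⟧ σ
⟦ a ⊖ b ⟧ σ = ⟦ a ⟧ σ ℤ.- ⟦ b ⟧ σ
⟦ a ⊗ b ⟧ σ = ⟦ a ⟧ σ ℤ.* ⟦ b ⟧ σ
⟦ a ≐ b ⟧ σ = b2z (does (⟦ a ⟧ σ ℤ.≟ ⟦ b ⟧ σ))
⟦ a ≺ b ⟧ σ = b2z (does (⟦ a ⟧ σ ℤ.<? ⟦ b ⟧ σ))

_⊨_ : State → Expr → Set
σ ⊨ e = ⟦ e ⟧ σ ≢ + 0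

_[_↦_] : State → Var → ℤ → State
(σ [ x ↦ v ]) y = ifᵇ (y ≡ᵇ x) then v else σ y

data Stmt : Set where
  _≔_          : Var → Expr → Stmt
  skip         : Stmt
  _⨾_          : Stmt → Stmt → Stmt
  if_then_else_ : Expr → Stmt → Stmt → Stmt
  while_loop_    : Expr → Stmt → Stmt

ν : {I : Set} {ℓ : Level} → ((I → Set) → I → Set ℓ) → I → Set (lsuc lzero ⊔ ℓ)
ν {I} F i = Σ (I → Set) (λ R → R i × (∀ j → R j → F R j))

-- A trace is represented by its sequence of states together with the
-- "last element" markers:  the trace denoted by  mkT st end  is
--   st 0 :: st 1 :: ... :: ⟨ st n ⟩   where n is the first index with end n = true,
-- and the infinite trace st 0 :: st 1 :: ... if there is no such n.
-- The destructor view is:  a trace τ is ⟨ hd τ ⟩ if  end τ 0 ≡ true,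
-- and it is  hd τ :: tl τ  if  end τ 0 ≡ false.

record Trace : Set where
  constructor mkT
  field
    st  : ℕ → State
    end : ℕ → Bool
open Trace public

hd : Trace → State
hd τ = st τ 0

tl : Trace → Trace
tl τ = mkT (λ n → st τ (ℕ.suc n)) (λ n → end τ (ℕ.suc n))

IsRet IsCons : Trace → Set
IsRet τ = end τ 0 ≡ true
IsCons τ = end τ 0 ≡ false

⟨_⟩ : State → Trace
⟨ σ ⟩ = mkT (λ _ → σ) (λ _ → true)

infixr 5 _∷_
_∷_ : State → Trace → Trace
σ ∷ τ = mkT (λ { ℕ.zero → σ ; (ℕ.suc n) → st τ n })
            (λ { ℕ.zero → false ; (ℕ.suc n) → end τ n })

BisimF : (Trace × Trace → Set) → Trace × Trace → Set
BisimF R (τ , τ') = hd τ ≡ hd τ' ×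
  ((IsRet τ × IsRet τ') ⊎ (IsCons τ × IsCons τ' × R (tl τ , tl τ')))

infix 4 _≈_
_≈_ : Trace → Trace → Set₁
τ ≈ τ' = ν BisimF (τ , τ')

-- Since traces are represented concretely, the output traces of the
-- axioms are specified up to bisimilarity.

ExecIdx : Set
ExecIdx = (Stmt × State × Trace) ⊎ (Stmt × Trace × Trace)

ExecF : (ExecIdx → Set) → ExecIdx → Set₁
ExecF R (inj₁ (x ≔ e , σ , τ)) = τ ≈ σ ∷ ⟨ σ [ x ↦ ⟦ e ⟧ σ ] ⟩
ExecF R (inj₁ (skip , σ , τ)) = τ ≈ ⟨ σ ⟩
ExecF R (inj₁ (s₀ ⨾ s₁ , σ , τ')) =
  Lift (lsuc lzero) (Σ Trace (λ τ → R (inj₁ (s₀ , σ , τ)) × R (inj₂ (s₁ , τ , τ'))))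
ExecF R (inj₁ (if e then sₜ else s_f , σ , τ)) = Lift (lsuc lzero)
  ((σ ⊨ e × R (inj₂ (sₜ , σ ∷ ⟨ σ ⟩ , τ)))
  ⊎ (¬ (σ ⊨ e) × R (inj₂ (s_f , σ ∷ ⟨ σ ⟩ , τ))))
ExecF R (inj₁ (while e loop sₜ , σ , τ')) =
    Lift (lsuc lzero) (σ ⊨ e × Σ Trace (λ τ → R (inj₂ (sₜ , σ ∷ ⟨ σ ⟩ , τ)) × R (inj₂ (while e loop sₜ , τ , τ'))))
  ⊎ (Lift (lsuc lzero) (¬ (σ ⊨ e)) × τ' ≈ σ ∷ ⟨ σ ⟩)
ExecF R (inj₂ (s , τ , τ')) =
    Lift (lsuc lzero) (IsRet τ × R (inj₁ (s , hd τ , τ')))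
  ⊎ Lift (lsuc lzero) (IsCons τ × IsCons τ' × hd τ ≡ hd τ' × R (inj₂ (s , tl τ , tl τ')))

Exec : Stmt → State → Trace → Set₁
Exec s σ τ = ν ExecF (inj₁ (s , σ , τ))

Exec* : Stmt → Trace → Trace → Set₁
Exec* s τ τ' = ν ExecF (inj₂ (s , τ , τ'))

≈-hd : ∀ {τ τ'} → τ ≈ τ' → hd τ ≡ hd τ'
≈-hd (R , r , step) with step _ r
... | h , _ = h

≈-ret : ∀ {τ τ'} → τ ≈ τ' → IsRet τ → IsRet τ'
≈-ret (R , r , step) p with step _ r
... | _ , inj₁ (_ , q) = q
... | _ , inj₂ (q , _) with trans (sym p) q
... | ()

≈-sym : ∀ {τ τ'} → τ ≈ τ' → τ' ≈ τ
≈-sym {τ} {τ'} (R , r , step) = (λ { (a , b) → R (b , a) }) , r , st'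
  where
  st' : ∀ j → R (Data.Product.proj₂ j , Data.Product.proj₁ j) → _
  st' (a , b) x with step (b , a) x
  ... | h , inj₁ (p , q) = sym h , inj₁ (q , p)
  ... | h , inj₂ (p , q , y) = sym h , inj₂ (q , p , y)

≈-trans : ∀ {τ₁ τ₂ τ₃} → τ₁ ≈ τ₂ → τ₂ ≈ τ₃ → τ₁ ≈ τ₃
≈-trans {τ₁} {τ₂} {τ₃} (R , r , stepR) (S , s , stepS) =
  (λ { (a , c) → Σ Trace (λ b → R (a , b) × S (b , c)) }) , (τ₂ , r , s) , st'
  where
  st' : ∀ j → Σ Trace (λ b → R (Data.Product.proj₁ j , b) × S (b , Data.Product.proj₂ j)) → _
  st' (a , c) (b , x , y) with stepR (a , b) x | stepS (b , c) y
  ... | h₁ , inj₁ (p , _) | h₂ , inj₁ (_ , q) = trans h₁ h₂ , inj₁ (p , q)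
  ... | h₁ , inj₂ (p , q , x') | h₂ , inj₂ (_ , q' , y') = trans h₁ h₂ , inj₂ (p , q' , tl b , x' , y')
  ... | _ , inj₁ (_ , q) | _ , inj₂ (q' , _) with trans (sym q) q'
  ... | ()
  st' (a , c) (b , x , y) | _ , inj₂ (_ , q , _) | _ , inj₁ (q' , _) with trans (sym q) q'
  ... | ()

SPred : Set₁
SPred = State → Set

_⊨ˢ_ : SPred → SPred → Set
U ⊨ˢ V = ∀ σ → U σ → V σ

⌊_⌋ : Expr → SPred
⌊ e ⌋ σ = σ ⊨ e

¬ˢ_ : SPred → SPred
(¬ˢ U) σ = ¬ U σ

infixr 5 _∧ˢ_
_∧ˢ_ : SPred → SPred → SPred
(U ∧ˢ V) σ = U σ × V σ

∃ˢ : {Z : Set} → (Z → SPred) → SPred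
∃ˢ {Z} U σ = Σ Z (λ z → U z σ)

record TPred : Set₂ where
  field
    pred : Trace → Set₁
    resp : ∀ {τ τ'} → τ ≈ τ' → pred τ → pred τ'
open TPred public

_⊨ᵗ_ : TPred → TPred → Set₁
P ⊨ᵗ Q = ∀ τ → pred P τ → pred Q τ

∃ᵗ : {Z : Set} → (Z → TPred) → TPred
pred (∃ᵗ {Z} P) τ = Σ Z (λ z → pred (P z) τ)
resp (∃ᵗ P) e (z , p) = z , resp (P z) e p

⟨_⟩ᵗ : SPred → TPred
pred ⟨ U ⟩ᵗ τ = Σ State (λ σ → U σ × τ ≈ ⟨ σ ⟩)
resp ⟨ U ⟩ᵗ e (σ , u , p) = σ , u , ≈-trans (≈-sym e) p

dup : SPred → TPred
pred (dup U) τ = Σ State (λ σ → U σ × τ ≈ σ ∷ ⟨ σ ⟩)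
resp (dup U) e (σ , u , p) = σ , u , ≈-trans (≈-sym e) p

_[_↦_]ᵗ : SPred → Var → Expr → TPred
pred (U [ x ↦ e ]ᵗ) τ = Σ State (λ σ → U σ × τ ≈ σ ∷ ⟨ σ [ x ↦ ⟦ e ⟧ σ ] ⟩)
resp (U [ x ↦ e ]ᵗ) p (σ , u , q) = σ , u , ≈-trans (≈-sym p) q

FollowsF : {ℓ : Level} → (Trace → Set ℓ) → (Trace × Trace → Set) → Trace × Trace → Set ℓ
FollowsF {ℓ} Q R (τ , τ') =
    (IsRet τ × hd τ' ≡ hd τ × Q τ')
  ⊎ Lift ℓ (IsCons τ × IsCons τ' × hd τ ≡ hd τ' × R (tl τ , tl τ'))

Follows : (Trace → Set₁) → Trace → Trace → Set₁
Follows Q τ τ' = ν (FollowsF Q) (τ , τ')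

follows-resp : (Q : TPred) → ∀ {τ τ₁ τ₂} → Follows (pred Q) τ τ₁ → τ₁ ≈ τ₂ → Follows (pred Q) τ τ₂
follows-resp Q {τ} {τ₁} {τ₂} (R , r , stepR) e@(S , s , stepS) =
  (λ { (a , c) → Σ Trace (λ b → R (a , b) × S (b , c)) }) , (τ₁ , r , s) , st'
  where
  st' : ∀ j → Σ Trace (λ b → R (Data.Product.proj₁ j , b) × S (b , Data.Product.proj₂ j)) → _
  st' (a , c) (b , x , y) with stepR (a , b) x | stepS (b , c) y
  ... | inj₁ (p , h , q) | h' , _ =
        inj₁ (p , trans (sym h') h , resp Q (S , y , stepS) q)
  ... | inj₂ (lift (p , q , h , x')) | h' , inj₂ (_ , q' , y') =
        inj₂ (lift (p , q' , trans h h' , tl b , x' , y'))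
  ... | inj₂ (lift (_ , q , _)) | _ , inj₁ (q' , _) with trans (sym q) q'
  ... | ()

infixr 5 _**_
_**_ : TPred → TPred → TPred
pred (P ** Q) τ' = Σ Trace (λ τ → pred P τ × Follows (pred Q) τ τ')
resp (P ** Q) e (τ , p , f) = τ , p , follows-resp Q f e

DagIdx : Set
DagIdx = Trace ⊎ (Trace × Trace)

DagF : TPred → (DagIdx → Set) → DagIdx → Set₁
DagF P R (inj₁ τ') = Lift (lsuc lzero) (IsRet τ') ⊎ Σ Trace (λ τ → pred P τ × R (inj₂ (τ , τ')))
DagF P R (inj₂ j) = Lift (lsuc lzero) (FollowsF (λ t → R (inj₁ t)) (λ k → R (inj₂ k)) j)

dag-resp : (P : TPred) → ∀ {τ τ'} → τ ≈ τ' → ν (DagF P) (inj₁ τ) → ν (DagF P) (inj₁ τ')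
dag-resp P {τ} {τ'} (S , s , stepS) (R , r , stepR) = R' , (τ , r , s) , st'
  where
  R' : DagIdx → Set
  R' (inj₁ c) = Σ Trace (λ b → R (inj₁ b) × S (b , c))
  R' (inj₂ (a , c)) = Σ Trace (λ b → R (inj₂ (a , b)) × S (b , c))
  st' : ∀ j → R' j → DagF P R' j
  st' (inj₁ c) (b , x , y) with stepR (inj₁ b) x | stepS (b , c) y
  ... | inj₁ (lift p) | _ , inj₁ (_ , q) = inj₁ (lift q)
  ... | inj₁ (lift p) | _ , inj₂ (q , _) with trans (sym p) q
  ... | ()
  st' (inj₁ c) (b , x , y) | inj₂ (τ₀ , p , z) | _ = inj₂ (τ₀ , p , b , z , y)
  st' (inj₂ (a , c)) (b , x , y) with stepR (inj₂ (a , b)) x | stepS (b , c) y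
  ... | lift (inj₁ (p , h , q)) | h' , _ = lift (inj₁ (p , trans (sym h') h , b , q , y))
  ... | lift (inj₂ (lift (p , q , h , x'))) | h' , inj₂ (_ , q' , y') =
        lift (inj₂ (lift (p , q' , trans h h' , tl b , x' , y')))
  ... | lift (inj₂ (lift (_ , q , _))) | _ , inj₁ (q' , _) with trans (sym q) q'
  ... | ()

_† : TPred → TPred
pred (P †) τ = ν (DagF P) (inj₁ τ)
resp (P †) = dag-resp P

data ⊢[_]_[_] : SPred → Stmt → TPred → Set₂ where
  hl-assign : ∀ {U x e} → ⊢[ U ] (x ≔ e) [ U [ x ↦ e ]ᵗ ]
  hl-skip   : ∀ {U} → ⊢[ U ] skip [ ⟨ U ⟩ᵗ ]
  hl-seq    : ∀ {U V s₀ s₁ P Q} → ⊢[ U ] s₀ [ P ** ⟨ V ⟩ᵗ ] → ⊢[ V ] s₁ [ Q ] →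
              ⊢[ U ] (s₀ ⨾ s₁) [ P ** Q ]
  hl-if     : ∀ {U e sₜ s_f P} → ⊢[ ⌊ e ⌋ ∧ˢ U ] sₜ [ P ] → ⊢[ (¬ˢ ⌊ e ⌋) ∧ˢ U ] s_f [ P ] →
              ⊢[ U ] (if e then sₜ else s_f) [ dup U ** P ]
  hl-while  : ∀ {U I e sₜ P} → U ⊨ˢ I → ⊢[ ⌊ e ⌋ ∧ˢ I ] sₜ [ P ** ⟨ I ⟩ᵗ ] →
              ⊢[ U ] (while e loop sₜ) [ dup U ** ((P ** dup I) † ** ⟨ ¬ˢ ⌊ e ⌋ ⟩ᵗ) ]
  hl-conseq : ∀ {U U' s P' P} → U ⊨ˢ U' → ⊢[ U' ] s [ P' ] → P' ⊨ᵗ P → ⊢[ U ] s [ P ]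
  hl-exists : ∀ {Z : Set} {U : Z → SPred} {s} {P : Z → TPred} →
              (∀ z → ⊢[ U z ] s [ P z ]) → ⊢[ ∃ˢ U ] s [ ∃ᵗ P ]

module Submission where

-- Every statement has a canonical run: a trace  run s σ  computed position by
-- position (traces are sequences of states with end markers, so the run is an
-- ordinary recursive function of the position, with no coinduction needed).
-- The proof has two independent halves.
--   1. The canonical run is an execution:  Exec s σ (run s σ).  A single
--      relation ("τ is pointwise the run") is shown to be a post-fixed point of
--      the evaluation functor.
--   2. The canonical run satisfies every derivable postcondition:
--      ⊢[ U ] s [ P ]  and  U σ  give  pred P (run s σ).  This is an induction
--      on the derivation; sequencing is handled by a general lemma on how
--      concatenation of traces interacts with  follows, and the while rule by
--      two coinductive arguments on the tail of the loop's run: it lies in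
--      (P ** dup I)†, and it follows itself into ⟨¬ e⟩ because the loop can
--      only stop in a state where the guard fails.

open import Defs
open import Data.Product using (Σ; _×_; _,_; proj₁; proj₂)
open import Data.Sum using (_⊎_; inj₁; inj₂)
open import Data.Bool using (Bool; true; false) renaming (if_then_else_ to ifᵇ_then_else_)
open import Data.Nat using (ℕ; zero; suc)
open import Data.Integer as ℤ using (+_)
open import Data.Empty using (⊥-elim)
open import Relation.Nullary using (¬_; does; yes; no)
open import Relation.Binary.PropositionalEquality using (_≡_; refl; sym; trans; cong; subst)
open import Level using (lift)

at : Trace → ℕ → State × Bool
at τ n = st τ n , end τ n

traceOf : (ℕ → State × Bool) → Trace
traceOf g = mkT (λ n → proj₁ (g n)) (λ n → proj₂ (g n))

-- Pointwise equality of traces; it is finer than bisimilarity, and is the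
-- equality in which the canonical runs are computed.
infix 4 _≗ₜ_
_≗ₜ_ : Trace → Trace → Set
τ ≗ₜ τ' = ∀ n → at τ n ≡ at τ' n

≗-sym : ∀ {τ τ'} → τ ≗ₜ τ' → τ' ≗ₜ τ
≗-sym p n = sym (p n)

≗-trans : ∀ {τ₁ τ₂ τ₃} → τ₁ ≗ₜ τ₂ → τ₂ ≗ₜ τ₃ → τ₁ ≗ₜ τ₃
≗-trans p q n = trans (p n) (q n)

≗-hd : ∀ {τ τ'} → τ ≗ₜ τ' → hd τ ≡ hd τ'
≗-hd p = cong proj₁ (p 0)

≗-end : ∀ {τ τ'} → τ ≗ₜ τ' → end τ 0 ≡ end τ' 0
≗-end p = cong proj₂ (p 0)

≗-tl : ∀ {τ τ'} → τ ≗ₜ τ' → tl τ ≗ₜ tl τ'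
≗-tl p n = p (suc n)

cons-view : ∀ {τ} → IsCons τ → τ ≗ₜ hd τ ∷ tl τ
cons-view c zero    = cong (_ ,_) c
cons-view c (suc n) = refl

data Shape (τ : Trace) : Set where
  ret  : IsRet τ → Shape τ
  cons : IsCons τ → Shape τ

shape : (τ : Trace) → Shape τ
shape τ with end τ 0 in eq
... | true  = ret eq
... | false = cons eq

ret≢cons : ∀ τ → IsRet τ → ¬ IsCons τ
ret≢cons τ r c with trans (sym r) c
... | ()

Pointwise : Trace × Trace → Set
Pointwise (τ , τ') = τ ≗ₜ τ'

≗⇒≈ : ∀ {τ τ'} → τ ≗ₜ τ' → τ ≈ τ'
≗⇒≈ p = Pointwise , p , step
  where
  step : ∀ j → Pointwise j → BisimF Pointwise j
  step (τ , τ') q with shape τ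
  ... | ret r  = ≗-hd q , inj₁ (r , trans (sym (≗-end q)) r)
  ... | cons c = ≗-hd q , inj₂ (c , trans (sym (≗-end q)) c , ≗-tl q)

≈-refl : ∀ {τ} → τ ≈ τ
≈-refl = ≗⇒≈ (λ _ → refl)

-- A trace final at position 0 is bisimilar to ⟨ its head ⟩ (whatever follows is junk).
ret≈ : ∀ {τ} → IsRet τ → τ ≈ ⟨ hd τ ⟩
ret≈ {τ} r = Final , (r , refl) , step
  where
  Final : Trace × Trace → Set
  Final (a , c) = IsRet a × c ≡ ⟨ hd a ⟩
  step : ∀ j → Final j → BisimF Final j
  step (a , c) (ra , refl) = refl , inj₁ (ra , refl)

-- τ ▷ f  runs τ and, once τ reaches its final state σ, continues as  f σ
-- (which is expected to start in σ, so σ is not repeated).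
catFrom : Bool → Trace → (State → Trace) → ℕ → State × Bool
catFrom true  τ f n       = at (f (hd τ)) n
catFrom false τ f zero    = hd τ , false
catFrom false τ f (suc n) = catFrom (end τ 1) (tl τ) f n

infixl 6 _▷_
_▷_ : Trace → (State → Trace) → Trace
τ ▷ f = traceOf (catFrom (end τ 0) τ f)

▷-ret : ∀ τ f → IsRet τ → τ ▷ f ≗ₜ f (hd τ)
▷-ret τ f r n rewrite r = refl

▷-cons : ∀ τ f → IsCons τ → τ ▷ f ≗ₜ hd τ ∷ (tl τ ▷ f)
▷-cons τ f c zero    rewrite c = refl
▷-cons τ f c (suc n) rewrite c = refl

▷-hd : ∀ τ {f} → (∀ σ → hd (f σ) ≡ σ) → hd (τ ▷ f) ≡ hd τ
▷-hd τ {f} hf with shape τ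
... | ret r  = trans (≗-hd (▷-ret τ f r)) (hf (hd τ))
... | cons c = ≗-hd (▷-cons τ f c)

duplicate : State → Trace
duplicate σ = σ ∷ ⟨ σ ⟩

duplicate-▷ : ∀ σ f → duplicate σ ▷ f ≗ₜ σ ∷ f σ
duplicate-▷ σ f zero    = refl
duplicate-▷ σ f (suc n) = refl

-- Testing a guard decides it, and records the Boolean on which runs branch.
guardFails : Expr → State → Bool
guardFails e σ = does (⟦ e ⟧ σ ℤ.≟ + 0)

data Guard (e : Expr) (σ : State) : Set where
  pass : σ ⊨ e → guardFails e σ ≡ false → Guard e σ
  fail : ¬ (σ ⊨ e) → guardFails e σ ≡ true → Guard e σ

guard : ∀ e σ → Guard e σ
guard e σ with ⟦ e ⟧ σ ℤ.≟ + 0 in eq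
... | yes p = fail (λ q → q p) (cong does eq)
... | no p  = pass p (cong does eq)

-- A loop is spelled out with its own
-- concatenation  bodyThenLoopAt  (positions of  τ ▷ run (while e loop b))
-- so that recursion visibly decreases the statement or the position.
mutual
  run : Stmt → State → Trace
  run s σ = traceOf (runAt s σ)

  runAt : Stmt → State → ℕ → State × Bool
  runAt (x ≔ e) σ = at (σ ∷ ⟨ σ [ x ↦ ⟦ e ⟧ σ ] ⟩)
  runAt skip σ _ = σ , true
  runAt (s₀ ⨾ s₁) σ = at (run s₀ σ ▷ run s₁)
  runAt (if e then sₜ else s_f) σ zero = σ , false
  runAt (if e then sₜ else s_f) σ (suc n) =
    ifᵇ guardFails e σ then runAt s_f σ n else runAt sₜ σ n
  runAt (while e loop b) σ = loopAt e b σ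

  loopAt : Expr → Stmt → State → ℕ → State × Bool
  loopAt e b σ zero = σ , false
  loopAt e b σ (suc n) =
    ifᵇ guardFails e σ then (σ , true)
    else bodyThenLoopAt (end (run b σ) 0) e b (run b σ) n

  bodyThenLoopAt : Bool → Expr → Stmt → Trace → ℕ → State × Bool
  bodyThenLoopAt true  e b τ n       = loopAt e b (hd τ) n
  bodyThenLoopAt false e b τ zero    = hd τ , false
  bodyThenLoopAt false e b τ (suc n) = bodyThenLoopAt (end τ 1) e b (tl τ) n

run-hd : ∀ s σ → hd (run s σ) ≡ σ
run-hd (x ≔ e) σ = refl
run-hd skip σ = refl
run-hd (s₀ ⨾ s₁) σ = trans (▷-hd (run s₀ σ) (run-hd s₁)) (run-hd s₀ σ)
run-hd (if e then sₜ else s_f) σ = refl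
run-hd (while e loop b) σ = refl

run-if-pass : ∀ {e σ} sₜ s_f → guardFails e σ ≡ false →
  run (if e then sₜ else s_f) σ ≗ₜ σ ∷ run sₜ σ
run-if-pass sₜ s_f g zero = refl
run-if-pass sₜ s_f g (suc n) rewrite g = refl

run-if-fail : ∀ {e σ} sₜ s_f → guardFails e σ ≡ true →
  run (if e then sₜ else s_f) σ ≗ₜ σ ∷ run s_f σ
run-if-fail sₜ s_f g zero = refl
run-if-fail sₜ s_f g (suc n) rewrite g = refl

module Loop (e : Expr) (b : Stmt) where

  w : Stmt
  w = while e loop b

  bodyThenLoop-▷ : ∀ bv τ n → bodyThenLoopAt bv e b τ n ≡ catFrom bv τ (run w) n
  bodyThenLoop-▷ true  τ n       = refl
  bodyThenLoop-▷ false τ zero    = refl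
  bodyThenLoop-▷ false τ (suc n) = bodyThenLoop-▷ (end τ 1) (tl τ) n

  run-while-fail : ∀ {σ} → guardFails e σ ≡ true → run w σ ≗ₜ σ ∷ ⟨ σ ⟩
  run-while-fail g zero = refl
  run-while-fail g (suc n) rewrite g = refl

  run-while-pass : ∀ {σ} → guardFails e σ ≡ false → run w σ ≗ₜ σ ∷ (run b σ ▷ run w)
  run-while-pass g zero = refl
  run-while-pass {σ} g (suc n) rewrite g = bodyThenLoop-▷ (end (run b σ) 0) (run b σ) n

  loop-second : ∀ σ → hd (tl (run w σ)) ≡ σ
  loop-second σ with guard e σ
  ... | fail _ g = ≗-hd (≗-tl (run-while-fail g))
  ... | pass _ g = trans (≗-hd (≗-tl (run-while-pass g)))
                         (trans (▷-hd (run b σ) (λ _ → refl)) (run-hd b σ))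

-- The canonical run is an execution:  s,σ ⇒ τ  holds for τ pointwise the run
-- and  s,τ ⇒* τ'  for τ' pointwise  τ ▷ run s,  because this relation is a
-- post-fixed point of the evaluation functor.
IsRun : ExecIdx → Set
IsRun (inj₁ (s , σ , τ))  = τ ≗ₜ run s σ
IsRun (inj₂ (s , τ , τ')) = τ' ≗ₜ τ ▷ run s

isRun-step : ∀ j → IsRun j → ExecF IsRun j
isRun-step (inj₁ (x ≔ e , σ , τ)) p = ≗⇒≈ p
isRun-step (inj₁ (skip , σ , τ)) p = ≗⇒≈ p
isRun-step (inj₁ (s₀ ⨾ s₁ , σ , τ)) p = lift (run s₀ σ , (λ _ → refl) , p)
isRun-step (inj₁ (if e then sₜ else s_f , σ , τ)) p with guard e σ
... | pass h g =
  lift (inj₁ (h , ≗-trans p (≗-trans (run-if-pass sₜ s_f g) (≗-sym (duplicate-▷ σ (run sₜ))))))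
... | fail h g =
  lift (inj₂ (h , ≗-trans p (≗-trans (run-if-fail sₜ s_f g) (≗-sym (duplicate-▷ σ (run s_f))))))
isRun-step (inj₁ (while e loop b , σ , τ)) p with guard e σ
... | pass h g = inj₁ (lift (h , σ ∷ run b σ , ≗-sym (duplicate-▷ σ (run b)) , loops))
  where
  open Loop e b
  loops : τ ≗ₜ (σ ∷ run b σ) ▷ run w
  loops = ≗-trans p (≗-trans (run-while-pass g) (≗-sym (▷-cons (σ ∷ run b σ) (run w) refl)))
... | fail h g = inj₂ (lift h , ≗⇒≈ (≗-trans p (run-while-fail g)))
  where open Loop e b
isRun-step (inj₂ (s , τ , τ')) p with shape τ
... | ret r  = inj₁ (lift (r , ≗-trans p (▷-ret τ (run s) r)))
... | cons c = inj₂ (lift (c , ≗-end p' , sym (≗-hd p') , ≗-tl p'))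
  where
  p' : τ' ≗ₜ hd τ ∷ (tl τ ▷ run s)
  p' = ≗-trans p (▷-cons τ (run s) c)

run-executes : ∀ s σ → Exec s σ (run s σ)
run-executes s σ = IsRun , (λ _ → refl) , isRun-step

data EndsAt : Trace → ℕ → Set where
  here  : ∀ {β} → IsRet β → EndsAt β zero
  there : ∀ {β n} → IsCons β → EndsAt (tl β) n → EndsAt β (suc n)

endsAt-marked : ∀ {β n} → EndsAt β n → end β n ≡ true
endsAt-marked (here r)    = r
endsAt-marked (there _ e) = endsAt-marked e

FinalIn : SPred → Trace → Set
FinalIn V β = ∀ {n} → EndsAt β n → V (st β n)

follows-final : ∀ V {τ₀ β} → Follows (pred ⟨ V ⟩ᵗ) τ₀ β → FinalIn V β
follows-final V {β = β} (R , r , step) (here rβ) with step _ r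
... | inj₁ (_ , _ , (σ , v , β≈σ)) = subst V (sym (≈-hd β≈σ)) v
... | inj₂ (lift (_ , cβ , _)) = ⊥-elim (ret≢cons β rβ cβ)
follows-final V {β = β} (R , r , step) (there cβ e) with step _ r
... | inj₁ (_ , _ , (σ , v , β≈σ)) = ⊥-elim (ret≢cons β (≈-ret (≈-sym β≈σ) refl) cβ)
... | inj₂ (lift (_ , _ , _ , r')) = follows-final V (R , r' , step) e

follows-self : ∀ {V β} → FinalIn V β → Follows (pred ⟨ V ⟩ᵗ) β β
follows-self {V} {β} fin = Diagonal , (refl , fin) , step
  where
  Diagonal : Trace × Trace → Set
  Diagonal (a , c) = a ≡ c × FinalIn V a
  step : ∀ j → Diagonal j → FollowsF (pred ⟨ V ⟩ᵗ) Diagonal j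
  step (a , c) (refl , fa) with shape a
  ... | ret r  = inj₁ (r , refl , (hd a , fa (here r) , ret≈ r))
  ... | cons k = inj₂ (lift (k , k , refl , refl , λ e → fa (there k e)))

follows-▷ : ∀ V (Q : TPred) {τ₀ β} (f : State → Trace) →
  Follows (pred ⟨ V ⟩ᵗ) τ₀ β → (∀ σ → V σ → pred Q (f σ)) → (∀ σ → hd (f σ) ≡ σ) →
  Follows (pred Q) τ₀ (β ▷ f)
follows-▷ V Q {β = β} f (R , r , step) fQ f-hd = Continued , (β , r , λ _ → refl) , step'
  where
  Continued : Trace × Trace → Set
  Continued (a , c) = Σ Trace λ b → R (a , b) × c ≗ₜ b ▷ f
  step' : ∀ j → Continued j → FollowsF (pred Q) Continued j
  step' (a , c) (b , rb , pc) with step (a , b) rb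
  ... | inj₁ (ra , hb , (σ , v , b≈σ)) =
    inj₁ (ra , trans (≗-hd pc') (trans (f-hd (hd b)) hb) ,
          resp Q (≗⇒≈ (≗-sym pc')) (fQ (hd b) (subst V (sym (≈-hd b≈σ)) v)))
    where
    pc' : c ≗ₜ f (hd b)
    pc' = ≗-trans pc (▷-ret b f (≈-ret (≈-sym b≈σ) refl))
  ... | inj₂ (lift (ca , cb , h , r')) =
    inj₂ (lift (ca , ≗-end pc' , trans h (sym (≗-hd pc')) , tl b , r' , ≗-tl pc'))
    where
    pc' : c ≗ₜ hd b ∷ (tl b ▷ f)
    pc' = ≗-trans pc (▷-cons b f cb)

follows-duplicate : ∀ (Q : TPred) {σ τ} → hd τ ≡ σ → pred Q τ →
  Follows (pred Q) (duplicate σ) (σ ∷ τ)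
follows-duplicate Q {σ} {τ} h q = Stage , inj₁ (refl , refl) , step
  where
  Stage : Trace × Trace → Set
  Stage (a , c) = (a ≡ duplicate σ × c ≡ σ ∷ τ) ⊎ (a ≡ ⟨ σ ⟩ × c ≡ τ)
  step : ∀ j → Stage j → FollowsF (pred Q) Stage j
  step _ (inj₁ (refl , refl)) = inj₂ (lift (refl , refl , refl , inj₂ (refl , refl)))
  step _ (inj₂ (refl , refl)) = inj₁ (refl , h , q)

module LoopPost (e : Expr) (b : Stmt) where
  open Loop e b

  mutual
    loopAt-marked : ∀ σ n → proj₂ (loopAt e b σ n) ≡ true → ¬ (proj₁ (loopAt e b σ n) ⊨ e)
    loopAt-marked σ zero ()
    loopAt-marked σ (suc n) with guard e σ
    ... | fail h g rewrite g = λ _ → h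
    ... | pass _ g rewrite g = bodyThenLoop-marked (end (run b σ) 0) (run b σ) n

    bodyThenLoop-marked : ∀ bv τ n → proj₂ (bodyThenLoopAt bv e b τ n) ≡ true →
      ¬ (proj₁ (bodyThenLoopAt bv e b τ n) ⊨ e)
    bodyThenLoop-marked true  τ n       = loopAt-marked (hd τ) n
    bodyThenLoop-marked false τ zero    ()
    bodyThenLoop-marked false τ (suc n) = bodyThenLoop-marked (end τ 1) (tl τ) n

  loop-final : ∀ σ → FinalIn (¬ˢ ⌊ e ⌋) (tl (run w σ))
  loop-final σ {n} ends = loopAt-marked σ (suc n) (endsAt-marked ends)

  module Iteration (I : SPred) (P : TPred)
    (body : ∀ σ → (⌊ e ⌋ ∧ˢ I) σ → pred (P ** ⟨ I ⟩ᵗ) (run b σ)) where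

    -- At (inj₁ c), c is the loop tail from an
    -- I-state.  At (inj₂ (a , c)), c follows the current iteration a: either
    -- the body run β is in progress (a = β ▷ duplicate, c = β ▷ run w) and
    -- will end in I, or it has ended in an I-state σ (a = ⟨σ⟩, c = loop tail from σ).
    Iterating : DagIdx → Set
    Iterating (inj₁ c) = Σ State λ σ → I σ × c ≗ₜ tl (run w σ)
    Iterating (inj₂ (a , c)) =
        (Σ Trace λ β → a ≗ₜ β ▷ duplicate × c ≗ₜ β ▷ run w × FinalIn I β)
      ⊎ (Σ State λ σ → I σ × a ≗ₜ ⟨ σ ⟩ × c ≗ₜ tl (run w σ))

    test-step : ∀ c → Iterating (inj₁ c) → DagF (P ** dup I) Iterating (inj₁ c)
    test-step c (σ , i , p) with guard e σ
    ... | fail _ g = inj₁ (lift (≗-end (≗-trans p (≗-tl (run-while-fail g)))))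
    ... | pass h g =
      let (τ₀ , pτ₀ , fol) = body σ (h , i)
          dupI = follows-▷ I (dup I) duplicate fol (λ σ' i' → σ' , i' , ≈-refl) (λ _ → refl)
      in inj₂ (run b σ ▷ duplicate , (τ₀ , pτ₀ , dupI) ,
               inj₁ (run b σ , (λ _ → refl) , ≗-trans p (≗-tl (run-while-pass g)) , follows-final I fol))

    iterate-step : ∀ a c → Iterating (inj₂ (a , c)) → DagF (P ** dup I) Iterating (inj₂ (a , c))
    iterate-step a c (inj₁ (β , pa , pc , fin)) with shape β
    ... | ret r =
      lift (inj₂ (lift (≗-end pa' , ≗-end pc' , trans (≗-hd pa') (sym (≗-hd pc')) ,
                        inj₂ (hd β , fin (here r) , ≗-tl pa' , ≗-tl pc'))))
      where
      pa' : a ≗ₜ duplicate (hd β)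
      pa' = ≗-trans pa (▷-ret β duplicate r)
      pc' : c ≗ₜ run w (hd β)
      pc' = ≗-trans pc (▷-ret β (run w) r)
    ... | cons k =
      lift (inj₂ (lift (≗-end pa' , ≗-end pc' , trans (≗-hd pa') (sym (≗-hd pc')) ,
                        inj₁ (tl β , ≗-tl pa' , ≗-tl pc' , λ e → fin (there k e)))))
      where
      pa' : a ≗ₜ hd β ∷ (tl β ▷ duplicate)
      pa' = ≗-trans pa (▷-cons β duplicate k)
      pc' : c ≗ₜ hd β ∷ (tl β ▷ run w)
      pc' = ≗-trans pc (▷-cons β (run w) k)
    iterate-step a c (inj₂ (σ , i , pa , pc)) =
      lift (inj₁ (≗-end pa , trans (≗-hd pc) (trans (loop-second σ) (sym (≗-hd pa))) , (σ , i , pc)))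

    loop-iterates : ∀ σ → I σ → pred ((P ** dup I) †) (tl (run w σ))
    loop-iterates σ i = Iterating , (σ , i , λ _ → refl) , step
      where
      step : ∀ j → Iterating j → DagF (P ** dup I) Iterating j
      step (inj₁ c)       = test-step c
      step (inj₂ (a , c)) = iterate-step a c

sound : ∀ {U s P} → ⊢[ U ] s [ P ] → ∀ σ → U σ → pred P (run s σ)
sound hl-assign σ u = σ , u , ≈-refl
sound hl-skip σ u = σ , u , ≈-refl
sound (hl-seq {V = V} {s₁ = s₁} {Q = Q} d₀ d₁) σ u =
  let (τ₀ , pτ₀ , fol) = sound d₀ σ u in
  τ₀ , pτ₀ , follows-▷ V Q (run s₁) fol (sound d₁) (run-hd s₁)
sound (hl-if {U} {e} {sₜ} {s_f} {P} dₜ d_f) σ u =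
  duplicate σ , (σ , u , ≈-refl) , branch (guard e σ)
  where
  branch : Guard e σ → Follows (pred P) (duplicate σ) (run (if e then sₜ else s_f) σ)
  branch (pass h g) = follows-resp P (follows-duplicate P (run-hd sₜ σ) (sound dₜ σ (h , u)))
                                     (≗⇒≈ (≗-sym (run-if-pass sₜ s_f g)))
  branch (fail h g) = follows-resp P (follows-duplicate P (run-hd s_f σ) (sound d_f σ (h , u)))
                                     (≗⇒≈ (≗-sym (run-if-fail sₜ s_f g)))
sound (hl-while {U} {I} {e} {b} {P} U⊨I d) σ u =
  duplicate σ , (σ , u , ≈-refl) ,
  follows-resp Post (follows-duplicate Post (loop-second σ) after-test) (≗⇒≈ (≗-sym (cons-view refl)))
  where
  open Loop e b
  open LoopPost e b
  open Iteration I P (sound d)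
  Post : TPred
  Post = (P ** dup I) † ** ⟨ ¬ˢ ⌊ e ⌋ ⟩ᵗ
  after-test : pred Post (tl (run w σ))
  after-test = tl (run w σ) , loop-iterates σ (U⊨I σ u) , follows-self (loop-final σ)
sound (hl-conseq U⊨U' d P'⊨P) σ u = P'⊨P _ (sound d σ (U⊨U' σ u))
sound (hl-exists ds) σ (z , u) = z , sound (ds z) σ u

corollary3p9 : ∀ {s : Stmt} {U : SPred} {P : TPred} → ⊢[ U ] s [ P ] →
    ∀ (σ : State) → U σ → Σ Trace (λ τ → Exec s σ τ × pred P τ)
corollary3p9 {s} d σ u = run s σ , run-executes s σ , sound d σ u
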